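{- Every regular language (over a finite alphabet $\Sigma$) is the language $L(\mathbb{A})$ of some stopwatch automaton $\mathbb{A}$.
   Context: A language is regular if it is accepted by some nondeterministic finite automaton. A (specific) stopwatch automaton is a tuple $\mathbb{A}=(Q,\Sigma,X,\lambda,\beta,\zeta,\Delta)$ where $Q$ is a finite set of states containing two distinguished states $\mathit{start}$ and $\mathit{accept}$; $\Sigma$ is a finite nonempty alphabet; $X$ is a finite set of stopwatches; $\lambda:Q\to\Sigma$; $\beta:X\to\mathbb{N}$ assigns each stopwatch its bound; $\zeta\subseteq X\times Q$ ($x$ is active in $q$ iff $(x,q)\in\zeta$); $\Delta$ is a finite set of transitions $(q,g,\alpha,q')$ with $g$ a guard and $\alpha$ an action. An assignment is $\xi:X\to\mathbb{N}$ with $\xi(x)\le\beta(x)$. Guards are Boolean circuits taking the binary encoding of an assignment (a block of $\lceil\log(\beta(x)+1)\rceil$ bits per stopwatch) and outputting one bit; actions are Boolean circuits mapping such encodings to encodings of numbers $v_x$, the resulting assignment being $x\mapsto\min\{v_x,\beta(x)\}$. Edges $(q,\xi)\stackrel{t}{\to}(q',\xi')$ between nodes (state, assignment): either $t=0$ and some $(q,g,\alpha,q')\in\Delta$ has $\xi$ satisfying $g$ and $\alpha(\xi)=\xi'$; or $t>0$, $q=q'$, and $\xi'(x)=\min\{\xi(x)+t,\beta(x)\}$ for $x$ active in $q$, $\xi'(x)=\xi(x)$ otherwise. A computation is a sequence $(q_0,\xi_0)\stackrel{t_0}{\to}\cdots\stackrel{t_{\ell-1}}{\to}(q_\ell,\xi_\ell)$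 with $q_i\ne\mathit{accept}$ for $i<\ell$; it is initial if $q_0=\mathit{start}$ and $\xi_0\equiv0$, accepting if $q_\ell=\mathit{accept}$, and reads $\lambda(q_0)^{t_0}\cdots\lambda(q_{\ell-1})^{t_{\ell-1}}$. $L(\mathbb{A})$ is the set of words read by initial accepting computations. -}

module Defs where

open import Data.Bool using (Bool; true; false; _∧_; _∨_; not; if_then_else_)
open import Data.Nat using (_≡ᵇ_; ℕ; zero; suc; _+_; _*_; _≤_; _<_; _⊓_; z≤n)
open import Data.Nat.DivMod using (_%_; _/_)
open import Data.Nat.Logarithm using (⌈log₂_⌉)
open import Data.Fin using (Fin; zero; suc)
import Data.Vec.Properties
import Data.Vec
open import Data.Vec using (Vec; []; _∷_; _∷ʳ_; lookup; tabulate; take; drop; _++_; replicate)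
open import Data.Vec.Relation.Unary.All using (All)
open import Data.List using (List; []; _∷_) renaming (_++_ to _++ₗ_; replicate to replicateₗ)
open import Data.List.Membership.Propositional using (_∈_)
open import Data.Product using (Σ; ∃; _×_; _,_)
open import Relation.Binary.PropositionalEquality using (_≡_; _≢_)
open import Function.Bundles using (_⇔_)

Language : ℕ → Set₁
Language s = List (Fin s) → Set

record NFA (s : ℕ) : Set where
  field
    nstates : ℕ
    initial : Fin nstates → Bool
    final   : Fin nstates → Bool
    δ       : Fin nstates → Fin s → Fin nstates → Bool

module _ {s : ℕ} (M : NFA s) where
  open NFA M

  data AcceptsFrom : Fin nstates → List (Fin s) → Set where
    nil  : ∀ {q} → final q ≡ true → AcceptsFrom q []
    cons : ∀ {q q' a w} → δ q a q' ≡ true → AcceptsFrom q' w →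
           AcceptsFrom q (a ∷ w)

  NFALang : Language s
  NFALang w = Σ (Fin nstates) λ q → (initial q ≡ true) × AcceptsFrom q w

Regular : ∀ {s} → Language s → Set
Regular {s} L = Σ (NFA s) λ M → ∀ w → L w ⇔ NFALang M w

data Gate (w : ℕ) : Set where
  andG : Fin w → Fin w → Gate w
  orG  : Fin w → Fin w → Gate w
  notG : Fin w → Gate w
  constG : Bool → Gate w

data Gates (n : ℕ) : ℕ → Set where
  []  : Gates n n
  _▹_ : ∀ {w} → Gates n w → Gate w → Gates n (suc w)

record Circuit (n m : ℕ) : Set where
  constructor circuit
  field
    wires   : ℕ
    gates   : Gates n wires
    outputs : Vec (Fin wires) m

evalGate : ∀ {w} → Vec Bool w → Gate w → Bool
evalGate v (andG i j) = lookup v i ∧ lookup v j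
evalGate v (orG i j)  = lookup v i ∨ lookup v j
evalGate v (notG i)   = not (lookup v i)
evalGate v (constG b) = b

evalGates : ∀ {n w} → Gates n w → Vec Bool n → Vec Bool w
evalGates [] inp = inp
evalGates (gs ▹ g) inp = let v = evalGates gs inp in v ∷ʳ evalGate v g

evalCircuit : ∀ {n m} → Circuit n m → Vec Bool n → Vec Bool m
evalCircuit (circuit _ gs outs) inp =
  let v = evalGates gs inp in Data.Vec.map (lookup v) outs

toBits : (b : ℕ) → ℕ → Vec Bool b
toBits zero v = []
toBits (suc b) v = (v % 2 ≡ᵇ 1) ∷ toBits b (v / 2)

fromBits : ∀ {b} → Vec Bool b → ℕ
fromBits [] = 0
fromBits (x ∷ xs) = (if x then 1 else 0) + 2 * fromBits xs

bitsFor : ℕ → ℕ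
bitsFor β = ⌈log₂ (suc β) ⌉

width : ∀ k → (Fin k → ℕ) → ℕ
width zero β = 0
width (suc k) β = bitsFor (β zero) + width k (λ x → β (suc x))

encode : ∀ k (β : Fin k → ℕ) → Vec ℕ k → Vec Bool (width k β)
encode zero β [] = []
encode (suc k) β (v ∷ vs) = toBits (bitsFor (β zero)) v ++ encode k (λ x → β (suc x)) vs

decode : ∀ k (β : Fin k → ℕ) → Vec Bool (width k β) → Vec ℕ k
decode zero β _ = []
decode (suc k) β bs =
  fromBits (take (bitsFor (β zero)) bs) ∷ decode k (λ x → β (suc x)) (drop (bitsFor (β zero)) bs)

record Transition (nq k : ℕ) (β : Fin k → ℕ) : Set where
  field
    src    : Fin nq
    guard  : Circuit (width k β) 1
    action : Circuit (width k β) (width k β)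
    tgt    : Fin nq

record StopwatchAutomaton (s : ℕ) : Set where
  field
    nq     : ℕ
    start  : Fin nq
    accept : Fin nq
    k      : ℕ
    label  : Fin nq → Fin s
    bound  : Fin k → ℕ
    active : Fin k → Fin nq → Bool
    Δ      : List (Transition nq k bound)

module _ {s : ℕ} (A : StopwatchAutomaton s) where
  open StopwatchAutomaton A

  IsAssignment : Vec ℕ k → Set
  IsAssignment ξ = ∀ x → lookup ξ x ≤ bound x

  record Node : Set where
    constructor node
    field
      state  : Fin nq
      assign : Vec ℕ k
      valid  : IsAssignment assign

  guardHolds : Circuit (width k bound) 1 → Vec ℕ k → Set
  guardHolds g ξ = evalCircuit g (encode k bound ξ) ≡ (true ∷ [])

  applyAction : Circuit (width k bound) (width k bound) → Vec ℕ k → Vec ℕ k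
  applyAction α ξ =
    let v = decode k bound (evalCircuit α (encode k bound ξ))
    in tabulate (λ x → lookup v x ⊓ bound x)

  elapse : Fin nq → ℕ → Vec ℕ k → Vec ℕ k
  elapse q t ξ = tabulate (λ x →
    if active x q then (lookup ξ x + t) ⊓ bound x else lookup ξ x)

  data Edge : Node → ℕ → Node → Set where
    discrete : ∀ {n n'} (tr : Transition nq k bound) → tr ∈ Δ →
               Transition.src tr ≡ Node.state n →
               Transition.tgt tr ≡ Node.state n' →
               guardHolds (Transition.guard tr) (Node.assign n) →
               applyAction (Transition.action tr) (Node.assign n) ≡ Node.assign n' →
               Edge n 0 n'
    delay : ∀ {n n'} (t : ℕ) → 0 < t →
            Node.state n ≡ Node.state n' →
            elapse (Node.state n) t (Node.assign n) ≡ Node.assign n' →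
            Edge n t n'

  data AcceptingFrom : Node → List (Fin s) → Set where
    done : ∀ {n} → Node.state n ≡ accept → AcceptingFrom n []
    step : ∀ {n n' t w} → Node.state n ≢ accept → Edge n t n' →
           AcceptingFrom n' w →
           AcceptingFrom n (replicateₗ t (label (Node.state n)) ++ₗ w)

  initialNode : Node
  initialNode = node start (replicate k 0) (λ x → zero≤ x)
    where
      zero≤ : ∀ x → lookup (replicate k 0) x ≤ bound x
      zero≤ x rewrite Data.Vec.Properties.lookup-replicate x 0 = z≤n

  SWLang : Language s
  SWLang w = AcceptingFrom initialNode w

-- Simulate an NFA M by a stopwatch automaton whose inner states are the pairs (q , a),
-- read as "M has just entered q by reading a", labelled a.  A single stopwatch with
-- bound 2 is reset by every transition and is always running; the guards leaving an
-- inner state demand the value 1, so every visit to an inner state lasts exactly one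
-- time unit and reads exactly one letter.  The start state must be left at time 0.
-- Soundness is proved against an explicit description of the words accepted from
-- each node of the automaton.
module Submission where

open import Defs
open import Data.Nat using (ℕ; suc; zero; _≤_; _<_; _+_; _*_; _⊓_; s≤s; z≤n)
open import Function.Bundles using (_⇔_; mk⇔; Equivalence)
open import Data.Product using (Σ; _×_; _,_; proj₁; proj₂)
open import Data.Bool using (Bool; true; false; _∧_)
open import Data.Bool.Properties using (∧-conicalˡ; ∧-conicalʳ)
open import Data.Empty using (⊥)
open import Data.Fin using (Fin; zero; suc; combine; remQuot; #_)
open import Data.Fin.Properties using (remQuot-combine)
open import Data.Vec using (Vec; []; _∷_)
open import Data.List using (List; []; _∷_; map; _++_; replicate; cartesianProductWith; allFin)
open import Data.List.Membership.Propositional using (_∈_)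
open import Data.List.Membership.Propositional.Properties
  using (∈-map⁺; ∈-map⁻; ∈-++⁺ˡ; ∈-++⁺ʳ; ∈-cartesianProductWith⁺; ∈-allFin)
open import Relation.Binary.PropositionalEquality using (_≡_; _≢_; refl; cong; cong₂)

boundTwo : Fin 1 → ℕ
boundTwo _ = 2

-- Wires 0 and 1 carry the stopwatch value in binary, least significant bit first.
isZeroAnd : Bool → Circuit 2 1
isZeroAnd c =
  circuit 7 ((((([] ▹ constG c) ▹ notG (# 0)) ▹ notG (# 1)) ▹ andG (# 3) (# 4)) ▹ andG (# 2) (# 5))
    (# 6 ∷ [])

isOneAnd : Bool → Circuit 2 1
isOneAnd c = circuit 4 (([] ▹ constG c) ▹ andG (# 2) (# 0)) (# 3 ∷ [])

reset : Circuit 2 2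
reset = circuit 3 ([] ▹ constG false) (# 2 ∷ # 2 ∷ [])

isZeroAnd-sound : ∀ c x → x ≤ 2 →
  evalCircuit (isZeroAnd c) (encode 1 boundTwo (x ∷ [])) ≡ true ∷ [] → c ≡ true × x ≡ 0
isZeroAnd-sound true  0 _ _ = refl , refl
isZeroAnd-sound false 0 _ ()
isZeroAnd-sound true  1 _ ()
isZeroAnd-sound false 1 _ ()
isZeroAnd-sound true  2 _ ()
isZeroAnd-sound false 2 _ ()
isZeroAnd-sound c (suc (suc (suc x))) (s≤s (s≤s ())) _

isOneAnd-sound : ∀ c x → x ≤ 2 →
  evalCircuit (isOneAnd c) (encode 1 boundTwo (x ∷ [])) ≡ true ∷ [] → c ≡ true × x ≡ 1
isOneAnd-sound true  0 _ ()
isOneAnd-sound false 0 _ ()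
isOneAnd-sound true  1 _ _ = refl , refl
isOneAnd-sound false 1 _ ()
isOneAnd-sound true  2 _ ()
isOneAnd-sound false 2 _ ()
isOneAnd-sound c (suc (suc (suc x))) (s≤s (s≤s ())) _

isZeroAnd-complete : ∀ {c} → c ≡ true →
  evalCircuit (isZeroAnd c) (encode 1 boundTwo (0 ∷ [])) ≡ true ∷ []
isZeroAnd-complete refl = refl

isOneAnd-complete : ∀ {c} → c ≡ true →
  evalCircuit (isOneAnd c) (encode 1 boundTwo (1 ∷ [])) ≡ true ∷ []
isOneAnd-complete refl = refl

module FromNFA {n : ℕ} (M : NFA (suc n)) where
  open NFA M

  Pair : Set
  Pair = Fin (nstates * suc n)

  stateOf : Pair → Fin nstates
  stateOf j = proj₁ (remQuot {nstates} (suc n) j)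

  letterOf : Pair → Fin (suc n)
  letterOf j = proj₂ (remQuot {nstates} (suc n) j)

  pair : ∀ q a → Σ Pair λ j → stateOf j ≡ q × letterOf j ≡ a
  pair q a = combine q a , cong proj₁ (remQuot-combine q a) , cong proj₂ (remQuot-combine q a)

  State : Set
  State = Fin (suc (suc (nstates * suc n)))

  pattern start   = zero
  pattern accept  = suc zero
  pattern inner j = suc (suc j)

  -- start and accept get an arbitrary letter: no accepting computation lets time pass there.
  label : State → Fin (suc n)
  label (inner j) = letterOf j
  label _         = zero

  data Move : Set where
    acceptAtOnce : Fin nstates → Move
    enter        : Fin nstates → Pair → Move
    advance      : Pair → Pair → Move
    finish       : Pair → Move

  acceptAtOnces enters advances finishes moves : List Move
  acceptAtOnces = map acceptAtOnce (allFin _)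
  enters        = cartesianProductWith enter (allFin _) (allFin _)
  advances      = cartesianProductWith advance (allFin _) (allFin _)
  finishes      = map finish (allFin _)
  moves         = acceptAtOnces ++ enters ++ advances ++ finishes

  ∈-moves : ∀ m → m ∈ moves
  ∈-moves (acceptAtOnce q) = ∈-++⁺ˡ (∈-map⁺ acceptAtOnce (∈-allFin q))
  ∈-moves (enter p j)      =
    ∈-++⁺ʳ acceptAtOnces (∈-++⁺ˡ (∈-cartesianProductWith⁺ enter (∈-allFin p) (∈-allFin j)))
  ∈-moves (advance i j)    = ∈-++⁺ʳ acceptAtOnces (∈-++⁺ʳ enters
    (∈-++⁺ˡ (∈-cartesianProductWith⁺ advance (∈-allFin i) (∈-allFin j))))
  ∈-moves (finish i)       = ∈-++⁺ʳ acceptAtOnces (∈-++⁺ʳ enters (∈-++⁺ʳ advances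
    (∈-map⁺ finish (∈-allFin i))))

  open Transition using (src; guard; action; tgt)

  transition : Move → Transition (suc (suc (nstates * suc n))) 1 boundTwo
  transition (acceptAtOnce q) = record
    { src = start ; guard = isZeroAnd (initial q ∧ final q) ; action = reset ; tgt = accept }
  transition (enter p j) = record
    { src = start ; guard = isZeroAnd (initial p ∧ δ p (letterOf j) (stateOf j))
    ; action = reset ; tgt = inner j }
  transition (advance i j) = record
    { src = inner i ; guard = isOneAnd (δ (stateOf i) (letterOf j) (stateOf j))
    ; action = reset ; tgt = inner j }
  transition (finish i) = record
    { src = inner i ; guard = isOneAnd (final (stateOf i)) ; action = reset ; tgt = accept }

  A : StopwatchAutomaton (suc n)
  A = record
    { nq = suc (suc (nstates * suc n)) ; start = start ; accept = accept ; k = 1 ; label = label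
    ; bound = boundTwo ; active = λ _ _ → true ; Δ = map transition moves }

  Residual : State → Vec ℕ 1 → Language (suc n)
  Residual start     (0 ∷ [])           w = NFALang M w
  Residual start     (suc _ ∷ [])       w = ⊥
  Residual accept    _                  w = w ≡ []
  Residual (inner j) (0 ∷ [])           w =
    Σ (List (Fin (suc n))) λ w' → w ≡ letterOf j ∷ w' × AcceptsFrom M (stateOf j) w'
  Residual (inner j) (1 ∷ [])           w = AcceptsFrom M (stateOf j) w
  Residual (inner j) (suc (suc _) ∷ []) w = ⊥

  Residual-delay : ∀ q x t w → 0 < t → q ≢ accept →
    Residual q ((x + t) ⊓ 2 ∷ []) w → Residual q (x ∷ []) (replicate t (label q) ++ w)
  Residual-delay start     zero          (suc t)       w _ _  ()
  Residual-delay start     (suc x)       (suc t)       w _ _  ()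
  Residual-delay accept    x             t             w _ ne _ with () ← ne refl
  Residual-delay (inner j) 0             1             w _ _  acc = w , refl , acc
  Residual-delay (inner j) 0             (suc (suc t)) w _ _  ()
  Residual-delay (inner j) 1             (suc t)       w _ _  ()
  Residual-delay (inner j) (suc (suc x)) t             w _ _  ()

  Residual-move : ∀ m x → x ≤ 2 → ∀ {ξ w} →
    guardHolds A (guard (transition m)) (x ∷ []) →
    applyAction A (action (transition m)) (x ∷ []) ≡ ξ →
    Residual (tgt (transition m)) ξ w →
    Residual (src (transition m)) (x ∷ []) w
  Residual-move (acceptAtOnce q) x x≤2 g refl refl
    with isZeroAnd-sound (initial q ∧ final q) x x≤2 g
  ... | c , refl = q , ∧-conicalˡ (initial q) (final q) c , nil (∧-conicalʳ (initial q) (final q) c)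
  Residual-move (enter p j) x x≤2 g refl (w , refl , acc)
    with isZeroAnd-sound (initial p ∧ δ p (letterOf j) (stateOf j)) x x≤2 g
  ... | c , refl = p , ∧-conicalˡ (initial p) _ c , cons (∧-conicalʳ (initial p) _ c) acc
  Residual-move (advance i j) x x≤2 g refl (w , refl , acc)
    with isOneAnd-sound (δ (stateOf i) (letterOf j) (stateOf j)) x x≤2 g
  ... | c , refl = cons c acc
  Residual-move (finish i) x x≤2 g refl refl with isOneAnd-sound (final (stateOf i)) x x≤2 g
  ... | c , refl = nil c

  sound : ∀ {m w} → AcceptingFrom A m w → Residual (Node.state m) (Node.assign m) w
  sound (done refl) = refl
  sound (step {n = node q (x ∷ []) _} ne (delay t 0<t refl refl) rest) =
    Residual-delay q x t _ 0<t ne (sound rest)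
  sound (step {n = node _ (x ∷ []) valid} _ (discrete tr tr∈Δ refl refl g act) rest)
    with ∈-map⁻ transition tr∈Δ
  ... | m , _ , refl = Residual-move m x (valid zero) g act (sound rest)

  resets : ∀ m x → applyAction A (action (transition m)) (x ∷ []) ≡ 0 ∷ []
  resets (acceptAtOnce _) _ = refl
  resets (enter _ _)      _ = refl
  resets (advance _ _)    _ = refl
  resets (finish _)       _ = refl

  nodeAt : State → (x : ℕ) → x ≤ 2 → Node A
  nodeAt q x x≤2 = node q (x ∷ []) λ { zero → x≤2 }

  fire : ∀ m {s : Node A} {w} →
    src (transition m) ≡ Node.state s → Node.state s ≢ accept →
    guardHolds A (guard (transition m)) (Node.assign s) →
    AcceptingFrom A (nodeAt (tgt (transition m)) 0 z≤n) w → AcceptingFrom A s w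
  fire m {node _ (x ∷ []) _} src≡ ne g rest =
    step ne (discrete (transition m) (∈-map⁺ transition (∈-moves m)) src≡ refl g (resets m x)) rest

  wait : ∀ j {w} → AcceptingFrom A (nodeAt (inner j) 1 (s≤s z≤n)) w →
    AcceptingFrom A (nodeAt (inner j) 0 z≤n) (letterOf j ∷ w)
  wait j rest = step (λ ()) (delay 1 (s≤s z≤n) refl refl) rest

  fromInner : ∀ j {w} → AcceptsFrom M (stateOf j) w →
    AcceptingFrom A (nodeAt (inner j) 1 (s≤s z≤n)) w
  fromInner j (nil f) = fire (finish j) refl (λ ()) (isOneAnd-complete f) (done refl)
  fromInner j (cons {q' = q} {a = a} d rest) with pair q a
  ... | j' , refl , refl =
    fire (advance j j') refl (λ ()) (isOneAnd-complete d) (wait j' (fromInner j' rest))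

  complete : ∀ {w} → NFALang M w → SWLang A w
  complete (p , ip , nil f) =
    fire (acceptAtOnce p) refl (λ ()) (isZeroAnd-complete (cong₂ _∧_ ip f)) (done refl)
  complete (p , ip , cons {q' = q} {a = a} d rest) with pair q a
  ... | j , refl , refl =
    fire (enter p j) refl (λ ()) (isZeroAnd-complete (cong₂ _∧_ ip d)) (wait j (fromInner j rest))

mainTheorem2 : (n : ℕ) (L : Language (suc n)) → Regular L →
    Σ (StopwatchAutomaton (suc n)) λ A → ∀ w → L w ⇔ SWLang A w
mainTheorem2 n L (M , L⇔M) = A , λ w →
  mk⇔ (λ w∈L → complete (Equivalence.to (L⇔M w) w∈L))
      (λ w∈A → Equivalence.from (L⇔M w) (sound w∈A))
  where open FromNFA M
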